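{- For every integer $n\geq 1$, \[ \sum_{\lambda\in L_n\cap \mathbb{Z}^n} z^{\lambda_n-\lambda_{n-1}} \;=\; \frac{A_{n-1}(z)}{(1-z)^{n}} \] as formal power series in $z$. Equivalently, the integer point transform of $L_n$ satisfies $\sigma_{L_n}(1,\ldots,1,z^{ -1},z)=A_{n-1}(z)/(1-z)^n$.
   Context: The lecture hall cone is $L_n:=\{\lambda\in\mathbb{R}^n : 0\le \frac{\lambda_1}{1}\le\frac{\lambda_2}{2}\le\cdots\le\frac{\lambda_n}{n}\}$. For $K\subseteq\mathbb{R}^n$, the integer point transform is $\sigma_K(z_1,\ldots,z_n)=\sum_{m\in K\cap\mathbb{Z}^n} z_1^{m_1}\cdots z_n^{m_n}$. For $\pi\in S_m$, $\mathrm{des}(\pi)=|\{i:1\le i\le m-1,\ \pi_i>\pi_{i+1}\}|$, and the Eulerian polynomial is $A_m(z)=\sum_{\pi\in S_m} z^{\mathrm{des}(\pi)}$ (so $A_0(z)=1$); equivalently $\sum_{t\ge0}(1+t)^m z^t = A_m(z)/(1-z)^{m+1}$. For $n=1$ one uses the convention $\lambda_0:=0$. -}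

module Defs where

open import Data.Nat as ℕ using (ℕ; zero; suc; _∸_; _<ᵇ_)
open import Data.Nat.Combinatorics using ()
open import Data.Integer as ℤ using (ℤ; +_; -[1+_])
open import Data.Bool using (if_then_else_)
open import Data.List using (List; []; _∷_; map; concatMap; length; filter; upTo)
open import Data.Vec using (Vec; []; _∷_)
open import Relation.Binary.PropositionalEquality using (_≡_)

-- Points of ℤⁿ, 1-indexed coordinates, with the convention λ₀ := 0.

coord : ∀ {n} → Vec ℤ n → ℕ → ℤ
coord v zero = + 0
coord [] (suc i) = + 0
coord (x ∷ v) (suc zero) = x
coord (x ∷ v) (suc (suc i)) = coord v (suc i)

-- Membership in the lecture hall cone L_n:
--   0 ≤ λ₁/1  and  λᵢ/i ≤ λᵢ₊₁/(i+1)  for 1 ≤ i < n,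
-- the latter written with denominators cleared: (i+1)·λᵢ ≤ i·λᵢ₊₁.
InL : (n : ℕ) → Vec ℤ n → Set
InL n v =
  (+ 0 ℤ.≤ coord v 1) ×'
  (∀ i → 1 ℕ.≤ i → i ℕ.< n → (+ suc i) ℤ.* coord v i ℤ.≤ (+ i) ℤ.* coord v (suc i))
  where
  open import Data.Product using () renaming (_×_ to _×'_)

FPS : Set
FPS = ℕ → ℤ

sumTo : ℕ → (ℕ → ℤ) → ℤ
sumTo zero f = f 0
sumTo (suc k) f = sumTo k f ℤ.+ f (suc k)

_*ₛ_ : FPS → FPS → FPS
(f *ₛ g) k = sumTo k (λ i → f i ℤ.* g (k ∸ i))

oneₛ : FPS
oneₛ zero = + 1
oneₛ (suc _) = + 0

oneMinusZ : FPS
oneMinusZ zero = + 1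
oneMinusZ (suc zero) = -[1+ 0 ]
oneMinusZ (suc (suc _)) = + 0

_^ₛ_ : FPS → ℕ → FPS
f ^ₛ zero = oneₛ
f ^ₛ suc n = f *ₛ (f ^ₛ n)

insertions : ℕ → List ℕ → List (List ℕ)
insertions x [] = (x ∷ []) ∷ []
insertions x (y ∷ ys) = (x ∷ y ∷ ys) ∷ map (y ∷_) (insertions x ys)

perms : List ℕ → List (List ℕ)
perms [] = [] ∷ []
perms (x ∷ xs) = concatMap (insertions x) (perms xs)

des : List ℕ → ℕ
des (a ∷ b ∷ r) = (if b <ᵇ a then 1 else 0) ℕ.+ des (b ∷ r)
des _ = 0

-- S_m realised as all permutations of the list [0, …, m-1]
-- (descents only depend on relative order).
-- Coefficient of z^j in A_m(z) = #{π ∈ S_m : des π = j}.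
eulerian : ℕ → FPS
eulerian m j = + length (filter (λ π → des π ℕ.≟ j) (perms (upTo m)))

-- The points of L_{m+1} with λ_{m+1} - λ_m = k are obtained from the points of L_m with
-- λ_m ≤ m k by appending λ_m + k. Splitting on the last coordinate, whose admissible range
-- below λ_{n+1} = j is λ_n ≤ ⌊n j / (n + 1)⌋, shows by induction that L_n has
-- (q + 1)^(n - r) (q + 2)^r points with λ_n ≤ n q + r (0 ≤ r ≤ n); hence there are
-- (k + 1)^m points with gap k. Multiplying Σ_k (k + 1)^m z^k by (1 - z)^(m+1) takes
-- (m + 1)-fold differences. These differences and the descent counts of S_m both obey
-- A_{m+1}(z) = (1 + m z) A_m(z) + z (1 - z) A_m'(z) with the same initial value; for
-- permutations this comes from inserting a new smallest letter into every gap.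

module Submission where

open import Defs
open import Data.Nat using (ℕ; suc)
open import Data.Vec using (Vec)
open import Data.List using (List; length)
open import Data.List.Relation.Unary.Unique.Propositional using (Unique)
open import Data.List.Membership.Propositional using (_∈_)
open import Data.Product using (Σ; _×_)
open import Function.Bundles using (_⇔_)
open import Relation.Binary.PropositionalEquality using (_≡_)

module PowerSeries where

  open import Data.Integer using (ℤ; +_; _-_)
  open import Data.Nat using (zero; _∸_; _^_; z≤n) renaming (_≤_ to _≤ℕ_)
  import Data.Nat.Properties as ℕ
  open import Data.Integer using (-[1+_]; _+_; _*_)
  import Data.Integer.Properties as ℤ
  open import Data.Integer.Tactic.RingSolver using (solve-∀)
  open import Relation.Binary.PropositionalEquality
    using (refl; sym; trans; cong; cong₂; _≗_; module ≡-Reasoning)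
  open ≡-Reasoning

  sumTo-cong : ∀ k {f g : ℕ → ℤ} → (∀ i → i ≤ℕ k → f i ≡ g i) → sumTo k f ≡ sumTo k g
  sumTo-cong zero eq = eq 0 z≤n
  sumTo-cong (suc k) eq =
    cong₂ _+_ (sumTo-cong k (λ i i≤k → eq i (ℕ.m≤n⇒m≤1+n i≤k))) (eq (suc k) ℕ.≤-refl)

  sumTo-zero : ∀ k {f : ℕ → ℤ} → (∀ i → i ≤ℕ k → f i ≡ + 0) → sumTo k f ≡ + 0
  sumTo-zero zero eq = eq 0 z≤n
  sumTo-zero (suc k) eq =
    cong₂ _+_ (sumTo-zero k (λ i i≤k → eq i (ℕ.m≤n⇒m≤1+n i≤k))) (eq (suc k) ℕ.≤-refl)

  sumTo-suc : ∀ k (f : ℕ → ℤ) → sumTo (suc k) f ≡ f 0 + sumTo k (λ i → f (suc i))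
  sumTo-suc zero f = refl
  sumTo-suc (suc k) f = trans (cong (_+ f (suc (suc k))) (sumTo-suc k f)) (ℤ.+-assoc (f 0) _ _)

  sumTo-minus : ∀ k (f g : ℕ → ℤ) → sumTo k (λ i → f i - g i) ≡ sumTo k f - sumTo k g
  sumTo-minus zero f g = refl
  sumTo-minus (suc k) f g =
    trans (cong (_+ (f (suc k) - g (suc k))) (sumTo-minus k f g))
          (interchange (sumTo k f) (sumTo k g) (f (suc k)) (g (suc k)))
    where
    interchange : ∀ a b c d → (a - b) + (c - d) ≡ (a + c) - (b + d)
    interchange = solve-∀

  *ₛ-congʳ : ∀ f {g h} → g ≗ h → f *ₛ g ≗ f *ₛ h
  *ₛ-congʳ f eq k = sumTo-cong k (λ i _ → cong (f i *_) (eq (k ∸ i)))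

  *ₛ-oneₛ : ∀ f → f *ₛ oneₛ ≗ f
  *ₛ-oneₛ f zero = ℤ.*-identityʳ (f 0)
  *ₛ-oneₛ f (suc k) = begin
    sumTo k (λ i → f i * oneₛ (suc k ∸ i)) + f (suc k) * oneₛ (k ∸ k)
      ≡⟨ cong₂ _+_ (sumTo-zero k (λ i i≤k → trans (cong (λ j → f i * oneₛ j) (ℕ.+-∸-assoc 1 i≤k))
                                                 (ℤ.*-zeroʳ (f i))))
                   (cong (λ j → f (suc k) * oneₛ j) (ℕ.n∸n≡0 k)) ⟩
    + 0 + f (suc k) * + 1
      ≡⟨ trans (ℤ.+-identityˡ _) (ℤ.*-identityʳ _) ⟩
    f (suc k) ∎

  Δ : FPS → FPS
  Δ f zero = f zero
  Δ f (suc t) = f (suc t) - f t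

  Δ^ : ℕ → FPS → FPS
  Δ^ zero f = f
  Δ^ (suc n) f = Δ (Δ^ n f)

  Δ-cong : ∀ {f g} → f ≗ g → Δ f ≗ Δ g
  Δ-cong eq zero = eq 0
  Δ-cong eq (suc t) = cong₂ _-_ (eq (suc t)) (eq t)

  Δ^-cong : ∀ n {f g} → f ≗ g → Δ^ n f ≗ Δ^ n g
  Δ^-cong zero eq = eq
  Δ^-cong (suc n) eq = Δ-cong (Δ^-cong n eq)

  oneMinusZ-*ₛ : ∀ f → oneMinusZ *ₛ f ≗ Δ f
  oneMinusZ-*ₛ f zero = ℤ.*-identityˡ (f 0)
  oneMinusZ-*ₛ f (suc zero) = cong₂ _+_ (ℤ.*-identityˡ (f 1)) (ℤ.-1*i≡-i (f 0))
  oneMinusZ-*ₛ f (suc (suc k)) = begin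
    sumTo (suc (suc k)) (λ i → oneMinusZ i * f (suc (suc k) ∸ i))
      ≡⟨ sumTo-suc (suc k) _ ⟩
    + 1 * f (suc (suc k)) + sumTo (suc k) (λ i → oneMinusZ (suc i) * f (suc k ∸ i))
      ≡⟨ cong (_+_ (+ 1 * f (suc (suc k)))) (sumTo-suc k _) ⟩
    + 1 * f (suc (suc k)) + (-[1+ 0 ] * f (suc k) + sumTo k (λ i → + 0 * f (k ∸ i)))
      ≡⟨ cong (λ s → + 1 * f (suc (suc k)) + (-[1+ 0 ] * f (suc k) + s)) (sumTo-zero k (λ _ _ → refl)) ⟩
    + 1 * f (suc (suc k)) + (-[1+ 0 ] * f (suc k) + + 0)
      ≡⟨ simplify (f (suc (suc k))) (f (suc k)) ⟩
    f (suc (suc k)) - f (suc k) ∎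
    where
    simplify : ∀ a b → + 1 * a + (-[1+ 0 ] * b + + 0) ≡ a - b
    simplify = solve-∀

  *ₛ-Δ : ∀ f g → f *ₛ Δ g ≗ Δ (f *ₛ g)
  *ₛ-Δ f g zero = refl
  *ₛ-Δ f g (suc k) = begin
    sumTo k (λ i → f i * Δ g (suc k ∸ i)) + f (suc k) * Δ g (k ∸ k)
      ≡⟨ cong₂ _+_ (sumTo-cong k distrib) (cong (λ j → f (suc k) * Δ g j) (ℕ.n∸n≡0 k)) ⟩
    sumTo k (λ i → f i * g (suc k ∸ i) - f i * g (k ∸ i)) + f (suc k) * g 0
      ≡⟨ cong (_+ f (suc k) * g 0) (sumTo-minus k _ _) ⟩
    (A - B) + f (suc k) * g 0
      ≡⟨ swap A B (f (suc k) * g 0) ⟩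
    (A + f (suc k) * g 0) - B
      ≡⟨ cong (λ j → (A + f (suc k) * g j) - B) (sym (ℕ.n∸n≡0 k)) ⟩
    Δ (f *ₛ g) (suc k) ∎
    where
    A = sumTo k (λ i → f i * g (suc k ∸ i))
    B = sumTo k (λ i → f i * g (k ∸ i))
    swap : ∀ a b c → (a - b) + c ≡ (a + c) - b
    swap = solve-∀
    *-distribˡ-minus : ∀ a b c → a * (b - c) ≡ a * b - a * c
    *-distribˡ-minus = solve-∀
    distrib : ∀ i → i ≤ℕ k → f i * Δ g (suc k ∸ i) ≡ f i * g (suc k ∸ i) - f i * g (k ∸ i)
    distrib i i≤k rewrite ℕ.+-∸-assoc 1 i≤k = *-distribˡ-minus (f i) _ _

  *ₛ-oneMinusZ^ : ∀ n f → f *ₛ (oneMinusZ ^ₛ n) ≗ Δ^ n f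
  *ₛ-oneMinusZ^ zero f = *ₛ-oneₛ f
  *ₛ-oneMinusZ^ (suc n) f k = begin
    (f *ₛ (oneMinusZ *ₛ (oneMinusZ ^ₛ n))) k ≡⟨ *ₛ-congʳ f (oneMinusZ-*ₛ (oneMinusZ ^ₛ n)) k ⟩
    (f *ₛ Δ (oneMinusZ ^ₛ n)) k              ≡⟨ *ₛ-Δ f (oneMinusZ ^ₛ n) k ⟩
    Δ (f *ₛ (oneMinusZ ^ₛ n)) k              ≡⟨ Δ-cong (*ₛ-oneMinusZ^ n f) k ⟩
    Δ^ (suc n) f k ∎

  -- θ f is the coefficient sequence of (z f)′.
  θ : FPS → FPS
  θ f t = + suc t * f t

  shift : FPS → FPS
  shift f zero = + 0
  shift f (suc t) = f t

  Δ-θ : ∀ f → Δ (θ f) ≗ λ t → θ (Δ f) t + shift f t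
  Δ-θ f zero = sym (ℤ.+-identityʳ _)
  Δ-θ f (suc t) = begin
    + suc (suc t) * f (suc t) - + suc t * f t
      ≡⟨ cong (λ s → s * f (suc t) - + suc t * f t) (ℤ.pos-+ 1 (suc t)) ⟩
    (+ 1 + + suc t) * f (suc t) - + suc t * f t
      ≡⟨ regroup (+ suc t) (f (suc t)) (f t) ⟩
    (+ 1 + + suc t) * (f (suc t) - f t) + f t
      ≡⟨ cong (λ s → s * (f (suc t) - f t) + f t) (sym (ℤ.pos-+ 1 (suc t))) ⟩
    θ (Δ f) (suc t) + shift f (suc t) ∎
    where
    regroup : ∀ s a b → (+ 1 + s) * a - s * b ≡ (+ 1 + s) * (a - b) + b
    regroup = solve-∀

  Δ-shift : ∀ f → Δ (shift f) ≗ shift (Δ f)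
  Δ-shift f zero = refl
  Δ-shift f (suc zero) = ℤ.+-identityʳ (f 0)
  Δ-shift f (suc (suc t)) = refl

  Δ-+-* : ∀ f g c → Δ (λ t → f t + c * g t) ≗ λ t → Δ f t + c * Δ g t
  Δ-+-* f g c zero = refl
  Δ-+-* f g c (suc t) = regroup (f (suc t)) (f t) (g (suc t)) (g t) c
    where
    regroup : ∀ a b x y c → (a + c * x) - (b + c * y) ≡ (a - b) + c * (x - y)
    regroup = solve-∀

  Δ^-θ : ∀ n f → Δ^ (suc n) (θ f) ≗ λ t → θ (Δ^ (suc n) f) t + + suc n * shift (Δ^ n f) t
  Δ^-θ zero f t = trans (Δ-θ f t) (cong (_+_ (θ (Δ f) t)) (sym (ℤ.*-identityˡ _)))
  Δ^-θ (suc n) f t = begin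
    Δ (Δ^ (suc n) (θ f)) t
      ≡⟨ Δ-cong (Δ^-θ n f) t ⟩
    Δ (λ s → θ g s + + suc n * shift h s) t
      ≡⟨ Δ-+-* (θ g) (shift h) (+ suc n) t ⟩
    Δ (θ g) t + + suc n * Δ (shift h) t
      ≡⟨ cong₂ (λ x y → x + + suc n * y) (Δ-θ g t) (Δ-shift h t) ⟩
    (θ (Δ g) t + shift g t) + + suc n * shift g t
      ≡⟨ collect (θ (Δ g) t) (shift g t) (+ suc n) ⟩
    θ (Δ g) t + (+ 1 + + suc n) * shift g t
      ≡⟨ cong (λ c → θ (Δ g) t + c * shift g t) (sym (ℤ.pos-+ 1 (suc n))) ⟩
    θ (Δ g) t + + suc (suc n) * shift g t ∎
    where
    g = Δ^ (suc n) f
    h = Δ^ n f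
    collect : ∀ a x c → (a + x) + c * x ≡ a + (+ 1 + c) * x
    collect = solve-∀

  -- On coefficients, A_{m+1}(z) = (1 + m z) A_m(z) + z (1 - z) A_m'(z).
  eulerianStep : ℕ → FPS → FPS
  eulerianStep m E t = θ (Δ E) t + + suc (suc m) * shift E t

  eulerianStep-cong : ∀ m {E E′} → E ≗ E′ → eulerianStep m E ≗ eulerianStep m E′
  eulerianStep-cong m eq zero = cong (λ x → + 1 * x + + suc (suc m) * + 0) (eq 0)
  eulerianStep-cong m eq (suc t) =
    cong₂ (λ x y → + suc (suc t) * x + + suc (suc m) * y) (Δ-cong eq (suc t)) (eq t)

  powers : ℕ → FPS
  powers m t = + (suc t ^ m)

  Δ^-powers-suc : ∀ m → Δ^ (suc (suc m)) (powers (suc m)) ≗ eulerianStep m (Δ^ (suc m) (powers m))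
  Δ^-powers-suc m t =
    trans (Δ^-cong (suc (suc m)) (λ s → ℤ.pos-* (suc s) (suc s ^ m)) t) (Δ^-θ (suc m) (powers m) t)

module EulerianNumbers where

  open import Data.Nat using (zero; _+_; _*_; _∸_; _≟_; _≡ᵇ_; _<ᵇ_; z≤n; s≤s) renaming (_≤_ to _≤ℕ_)
  import Data.Nat.Properties as ℕ
  open import Data.Nat.Tactic.RingSolver using (solve-∀)
  open import Data.Bool using (true; false; if_then_else_)
  open import Data.List using ([]; _∷_; map; concatMap; filter; upTo; _++_)
  import Data.List.Properties as List
  open import Data.List.Relation.Unary.All as All using (All; []; _∷_)
  import Data.List.Relation.Unary.All.Properties as All
  open import Function using (_∘_)
  open import Relation.Nullary using (does; yes; no)
  open import Relation.Nullary.Decidable using (dec-true; dec-false)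
  open import Relation.Binary.PropositionalEquality
    using (refl; sym; trans; cong; cong₂; subst; _≢_; module ≡-Reasoning)
  open ≡-Reasoning

  δ : ℕ → ℕ → ℕ
  δ a b = if does (a ≟ b) then 1 else 0

  δ-refl : ∀ a → δ a a ≡ 1
  δ-refl a = cong (λ b → if b then 1 else 0) (dec-true (a ≟ a) refl)

  δ-≢ : ∀ {a b} → a ≢ b → δ a b ≡ 0
  δ-≢ {a} {b} a≢b = cong (λ b → if b then 1 else 0) (dec-false (a ≟ b) a≢b)

  #des : ℕ → List (List ℕ) → ℕ
  #des d [] = 0
  #des d (π ∷ Π) = δ (des π) d + #des d Π

  #des≡length-filter : ∀ d Π → #des d Π ≡ length (filter (λ π → des π ≟ d) Π)
  #des≡length-filter d [] = refl
  #des≡length-filter d (π ∷ Π) with des π ≡ᵇ d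
  ... | true = cong suc (#des≡length-filter d Π)
  ... | false = #des≡length-filter d Π

  #des-++ : ∀ d Π Π′ → #des d (Π ++ Π′) ≡ #des d Π + #des d Π′
  #des-++ d [] Π′ = refl
  #des-++ d (π ∷ Π) Π′ = trans (cong (δ (des π) d +_) (#des-++ d Π Π′)) (sym (ℕ.+-assoc (δ (des π) d) _ _))

  δ-+ : ∀ t a b → δ (t + a) (t + b) ≡ δ a b
  δ-+ zero a b = refl
  δ-+ (suc t) a b = δ-+ t a b

  #des-cons-cons : ∀ {y y′ x} → (y′ <ᵇ y) ≡ x → ∀ d Q →
    #des ((if x then 1 else 0) + d) (map (y ∷_) (map (y′ ∷_) Q)) ≡ #des d (map (y′ ∷_) Q)
  #des-cons-cons refl d [] = refl
  #des-cons-cons {y} {y′} refl d (q ∷ Q) =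
    cong₂ _+_ (δ-+ (if y′ <ᵇ y then 1 else 0) (des (y′ ∷ q)) d) (#des-cons-cons refl d Q)

  #des-cons-cons-zero : ∀ {y y′} → (y′ <ᵇ y) ≡ true → ∀ Q → #des 0 (map (y ∷_) (map (y′ ∷_) Q)) ≡ 0
  #des-cons-cons-zero descent [] = refl
  #des-cons-cons-zero descent (q ∷ Q) rewrite descent = #des-cons-cons-zero descent Q

  des≤length : ∀ π → des π ≤ℕ length π
  des≤length [] = z≤n
  des≤length (a ∷ []) = z≤n
  des≤length (a ∷ b ∷ π) = indicator+ (b <ᵇ a) (des≤length (b ∷ π))
    where
    indicator+ : ∀ c {x n} → x ≤ℕ n → (if c then 1 else 0) + x ≤ℕ suc n
    indicator+ true x≤n = s≤s x≤n
    indicator+ false x≤n = ℕ.m≤n⇒m≤1+n x≤n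

  des-map-suc : ∀ σ → des (map suc σ) ≡ des σ
  des-map-suc [] = refl
  des-map-suc (a ∷ []) = refl
  des-map-suc (a ∷ b ∷ σ) = cong ((if b <ᵇ a then 1 else 0) +_) (des-map-suc (b ∷ σ))

  des-zero-∷ : ∀ ys → des (0 ∷ ys) ≡ des ys
  des-zero-∷ [] = refl
  des-zero-∷ (y ∷ ys) = refl

  laterInsertions : List ℕ → List (List ℕ)
  laterInsertions [] = []
  laterInsertions (y ∷ ys) = map (y ∷_) (insertions 0 ys)

  insertions-zero : ∀ ys → insertions 0 ys ≡ (0 ∷ ys) ∷ laterInsertions ys
  insertions-zero [] = refl
  insertions-zero (y ∷ ys) = refl

  -- Inserting 0 right after a descent top keeps the descent number D; each of the
  -- remaining length σ ∸ D later positions raises it to D + 1.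
  LaterInsertionCount : List ℕ → Set
  LaterInsertionCount σ = ∀ d →
    #des d (laterInsertions (map suc σ)) ≡ δ D d * D + δ (suc D) d * (length σ ∸ D)
    where D = des (map suc σ)

  laterInsertionCount-∷-∷ : ∀ a b σ → LaterInsertionCount (b ∷ σ) → LaterInsertionCount (a ∷ b ∷ σ)
  laterInsertionCount-∷-∷ a b σ count d with b <ᵇ a in descentAtHead
  ... | false = begin
      δ (suc D) d + #des d (map (suc a ∷_) (map (suc b ∷_) Q))
        ≡⟨ cong (δ (suc D) d +_) (trans (#des-cons-cons descentAtHead d Q) (count d)) ⟩
      δ (suc D) d + (δ D d * D + δ (suc D) d * (L ∸ D))
        ≡⟨ regroup (δ (suc D) d) (δ D d * D) (L ∸ D) ⟩
      δ D d * D + δ (suc D) d * suc (L ∸ D)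
        ≡⟨ cong (λ x → δ D d * D + δ (suc D) d * x) (sym (ℕ.+-∸-assoc 1 D≤L)) ⟩
      δ D d * D + δ (suc D) d * (suc L ∸ D) ∎
    where
    D = des (suc b ∷ map suc σ)
    L = length (b ∷ σ)
    Q = insertions 0 (map suc σ)
    D≤L : D ≤ℕ L
    D≤L = subst (D ≤ℕ_) (List.length-map suc (b ∷ σ)) (des≤length (suc b ∷ map suc σ))
    regroup : ∀ x y z → x + (y + x * z) ≡ y + x * suc z
    regroup = solve-∀
  ... | true with d
  ...   | zero = cong (δ (suc (des (suc b ∷ map suc σ))) 0 +_)
                      (#des-cons-cons-zero descentAtHead (insertions 0 (map suc σ)))
  ...   | suc d′ = begin
      δ D d′ + #des (suc d′) (map (suc a ∷_) (map (suc b ∷_) Q))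
        ≡⟨ cong (δ D d′ +_) (trans (#des-cons-cons descentAtHead d′ Q) (count d′)) ⟩
      δ D d′ + (δ D d′ * D + δ (suc D) d′ * (L ∸ D))
        ≡⟨ regroup (δ D d′) D (δ (suc D) d′ * (L ∸ D)) ⟩
      δ D d′ * suc D + δ (suc D) d′ * (L ∸ D) ∎
    where
    D = des (suc b ∷ map suc σ)
    L = length (b ∷ σ)
    Q = insertions 0 (map suc σ)
    regroup : ∀ x y z → x + (x * y + z) ≡ x * suc y + z
    regroup = solve-∀

  laterInsertionCount : ∀ σ → LaterInsertionCount σ
  laterInsertionCount [] d = sym (cong₂ _+_ (ℕ.*-zeroʳ (δ 0 d)) (ℕ.*-zeroʳ (δ 1 d)))
  laterInsertionCount (a ∷ []) d =
    trans (ℕ.+-identityʳ (δ 1 d)) (sym (cong₂ _+_ (ℕ.*-zeroʳ (δ 0 d)) (ℕ.*-identityʳ (δ 1 d))))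
  laterInsertionCount (a ∷ b ∷ σ) = laterInsertionCount-∷-∷ a b σ (laterInsertionCount (b ∷ σ))

  #des-insertions-zero : ∀ σ d →
    #des d (insertions 0 (map suc σ)) ≡ δ (des σ) d * suc (des σ) + δ (suc (des σ)) d * (length σ ∸ des σ)
  #des-insertions-zero σ d = begin
    #des d (insertions 0 (map suc σ))
      ≡⟨ cong (#des d) (insertions-zero (map suc σ)) ⟩
    δ (des (0 ∷ map suc σ)) d + #des d (laterInsertions (map suc σ))
      ≡⟨ cong₂ _+_ (cong (λ x → δ x d) (trans (des-zero-∷ (map suc σ)) (des-map-suc σ)))
                   (laterInsertionCount σ d) ⟩
    δ D d + (δ D′ d * D′ + δ (suc D′) d * (length σ ∸ D′))
      ≡⟨ cong (λ x → δ D d + (δ x d * x + δ (suc x) d * (length σ ∸ x))) (des-map-suc σ) ⟩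
    δ D d + (δ D d * D + δ (suc D) d * (length σ ∸ D))
      ≡⟨ regroup (δ D d) D (δ (suc D) d * (length σ ∸ D)) ⟩
    δ D d * suc D + δ (suc D) d * (length σ ∸ D) ∎
    where
    D = des σ
    D′ = des (map suc σ)
    regroup : ∀ x y z → x + (x * y + z) ≡ x * suc y + z
    regroup = solve-∀

  insertionCount-zero : ∀ D x → δ D 0 * suc D + δ (suc D) 0 * x ≡ δ D 0
  insertionCount-zero zero x = refl
  insertionCount-zero (suc D) x = refl

  insertionCount-suc : ∀ D L d → D ≤ℕ L →
    (δ D (suc d) * suc D + δ D d * (L ∸ D)) + suc (suc d) * δ D d ≡
    suc (suc d) * δ D (suc d) + suc (suc L) * δ D d
  insertionCount-suc D L d D≤L with D ≟ d
  ... | yes refl rewrite δ-refl D | δ-≢ (ℕ.1+n≢n ∘ sym {x = D}) = begin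
      0 * suc D + 1 * (L ∸ D) + suc (suc D) * 1 ≡⟨ lhs (L ∸ D) D ⟩
      suc (suc ((L ∸ D) + D))                   ≡⟨ cong (suc ∘ suc) (ℕ.m∸n+n≡m D≤L) ⟩
      suc (suc L)                               ≡⟨ rhs D L ⟨
      suc (suc D) * 0 + suc (suc L) * 1 ∎
    where
    lhs : ∀ x D → 0 * suc D + 1 * x + suc (suc D) * 1 ≡ suc (suc (x + D))
    lhs = solve-∀
    rhs : ∀ D L → suc (suc D) * 0 + suc (suc L) * 1 ≡ suc (suc L)
    rhs = solve-∀
  ... | no D≢d with D ≟ suc d
  ...   | yes refl rewrite δ-refl (suc d) | δ-≢ (ℕ.1+n≢n {d}) = simplify d (L ∸ suc d) L
    where
    simplify : ∀ d x L → 1 * suc (suc d) + 0 * x + suc (suc d) * 0 ≡ suc (suc d) * 1 + suc (suc L) * 0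
    simplify = solve-∀
  ...   | no D≢1+d rewrite δ-≢ D≢1+d | δ-≢ D≢d = simplify D (L ∸ D) d L
    where
    simplify : ∀ D x d L → 0 * suc D + 0 * x + suc (suc d) * 0 ≡ suc (suc d) * 0 + suc (suc L) * 0
    simplify = solve-∀

  insertZero : List (List ℕ) → List (List ℕ)
  insertZero Π = concatMap (insertions 0) (map (map suc) Π)

  #des-insertZero-zero : ∀ Π → #des 0 (insertZero Π) ≡ #des 0 Π
  #des-insertZero-zero [] = refl
  #des-insertZero-zero (σ ∷ Π) = begin
    #des 0 (insertions 0 (map suc σ) ++ insertZero Π)          ≡⟨ #des-++ 0 (insertions 0 (map suc σ)) _ ⟩
    #des 0 (insertions 0 (map suc σ)) + #des 0 (insertZero Π)
      ≡⟨ cong₂ _+_ (trans (#des-insertions-zero σ 0) (insertionCount-zero (des σ) (length σ ∸ des σ)))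
                   (#des-insertZero-zero Π) ⟩
    δ (des σ) 0 + #des 0 Π ∎

  #des-insertZero-suc : ∀ m d Π → All (λ σ → length σ ≡ m) Π →
    #des (suc d) (insertZero Π) + suc (suc d) * #des d Π ≡
    suc (suc d) * #des (suc d) Π + suc (suc m) * #des d Π
  #des-insertZero-suc m d [] [] = zeros (suc (suc d)) (suc (suc m))
    where
    zeros : ∀ k M → 0 + k * 0 ≡ k * 0 + M * 0
    zeros = solve-∀
  #des-insertZero-suc _ d (σ ∷ Π) (refl ∷ lengths) = begin
    #des (suc d) (insertions 0 (map suc σ) ++ insertZero Π) + k * (δ D d + #des d Π)
      ≡⟨ cong (_+ k * (δ D d + #des d Π)) (#des-++ (suc d) (insertions 0 (map suc σ)) _) ⟩
    (c + #des (suc d) (insertZero Π)) + k * (δ D d + #des d Π)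
      ≡⟨ interchange c (#des (suc d) (insertZero Π)) (δ D d) (#des d Π) ⟩
    (c + k * δ D d) + (#des (suc d) (insertZero Π) + k * #des d Π)
      ≡⟨ cong₂ _+_ (trans (cong (λ x → x + k * δ D d) (#des-insertions-zero σ (suc d)))
                          (insertionCount-suc D (length σ) d (des≤length σ)))
                   (#des-insertZero-suc (length σ) d Π lengths) ⟩
    (k * δ D (suc d) + M * δ D d) + (k * #des (suc d) Π + M * #des d Π)
      ≡⟨ collect (δ D (suc d)) (δ D d) (#des (suc d) Π) (#des d Π) ⟩
    k * (δ D (suc d) + #des (suc d) Π) + M * (δ D d + #des d Π) ∎
    where
    D = des σ
    k = suc (suc d)
    M = suc (suc (length σ))
    c = #des (suc d) (insertions 0 (map suc σ))
    interchange : ∀ a b x y → (a + b) + k * (x + y) ≡ (a + k * x) + (b + k * y)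
    interchange = solve-∀
    collect : ∀ a b x y → (k * a + M * b) + (k * x + M * y) ≡ k * (a + x) + M * (b + y)
    collect = solve-∀

  insertions-map : ∀ (f : ℕ → ℕ) x σ → insertions (f x) (map f σ) ≡ map (map f) (insertions x σ)
  insertions-map f x [] = refl
  insertions-map f x (y ∷ ys) = cong ((f x ∷ f y ∷ map f ys) ∷_) (begin
    map (f y ∷_) (insertions (f x) (map f ys))      ≡⟨ cong (map (f y ∷_)) (insertions-map f x ys) ⟩
    map (f y ∷_) (map (map f) (insertions x ys))    ≡⟨ List.map-∘ (insertions x ys) ⟨
    map (map f ∘ (y ∷_)) (insertions x ys)          ≡⟨ List.map-∘ (insertions x ys) ⟩
    map (map f) (map (y ∷_) (insertions x ys)) ∎)

  perms-map : ∀ (f : ℕ → ℕ) l → perms (map f l) ≡ map (map f) (perms l)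
  perms-map f [] = refl
  perms-map f (x ∷ xs) = begin
    concatMap (insertions (f x)) (perms (map f xs))        ≡⟨ cong (concatMap (insertions (f x))) (perms-map f xs) ⟩
    concatMap (insertions (f x)) (map (map f) (perms xs))  ≡⟨ List.concatMap-map (insertions (f x)) (map f) (perms xs) ⟩
    concatMap (insertions (f x) ∘ map f) (perms xs)        ≡⟨ List.concatMap-cong (insertions-map f x) (perms xs) ⟩
    concatMap (map (map f) ∘ insertions x) (perms xs)      ≡⟨ List.map-concatMap (map f) (insertions x) (perms xs) ⟨
    map (map f) (concatMap (insertions x) (perms xs)) ∎

  perms-upTo-suc : ∀ m → perms (upTo (suc m)) ≡ insertZero (perms (upTo m))
  perms-upTo-suc m =
    cong (concatMap (insertions 0)) (trans (cong perms (sym (List.map-upTo suc m))) (perms-map suc (upTo m)))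

  insertions-length : ∀ x σ → All (λ τ → length τ ≡ suc (length σ)) (insertions x σ)
  insertions-length x [] = refl ∷ []
  insertions-length x (y ∷ ys) = refl ∷ All.map⁺ (All.map (cong suc) (insertions-length x ys))

  perms-length : ∀ l → All (λ π → length π ≡ length l) (perms l)
  perms-length [] = refl ∷ []
  perms-length (x ∷ xs) = All.concat⁺ (All.map⁺ (All.map
    (λ {σ} σ-length → All.map (λ τ-length → trans τ-length (cong suc σ-length)) (insertions-length x σ))
    (perms-length xs)))

  #des-perms-suc-zero : ∀ m → #des 0 (perms (upTo (suc m))) ≡ #des 0 (perms (upTo m))
  #des-perms-suc-zero m = trans (cong (#des 0) (perms-upTo-suc m)) (#des-insertZero-zero (perms (upTo m)))

  #des-perms-suc : ∀ m d →
    #des (suc d) (perms (upTo (suc m))) + suc (suc d) * #des d (perms (upTo m)) ≡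
    suc (suc d) * #des (suc d) (perms (upTo m)) + suc (suc m) * #des d (perms (upTo m))
  #des-perms-suc m d rewrite perms-upTo-suc m =
    #des-insertZero-suc m d (perms (upTo m))
      (All.map (λ π-length → trans π-length (List.length-upTo m)) (perms-length (upTo m)))

module LectureHallPoints where

  open import Data.Nat using (zero; _+_; _*_; _∸_; _^_; _≤_; _<_; z≤n; s≤s; s≤s⁻¹)
  import Data.Nat.Properties as ℕ
  open import Data.Nat.DivMod using (_/_; m*n/n≡m; m/n*n≤m; /-monoˡ-≤; +-distrib-/-∣ˡ; m<n⇒m/n≡0)
  open import Data.Nat.Divisibility using (n∣m*n)
  open import Data.Nat.Tactic.RingSolver using (solve-∀)
  open import Data.Vec using (Vec; []; _∷_; _∷ʳ_; initLast)
  import Data.Vec.Properties as Vec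
  open import Data.List using ([]; _∷_; map; _++_)
  import Data.List.Properties as List
  open import Data.List.Membership.Propositional.Properties
    using (∈-map⁺; ∈-map⁻; ∈-++⁺ˡ; ∈-++⁺ʳ; ∈-++⁻)
  open import Data.List.Relation.Unary.Any using (here)
  open import Data.List.Relation.Unary.All using ([])
  open import Data.List.Relation.Unary.AllPairs using ([]; _∷_)
  import Data.List.Relation.Unary.Unique.Propositional.Properties as Unique
  open import Relation.Nullary using (¬_)
  open import Function.Bundles using (mk⇔; Equivalence)
  open import Data.Product using (_,_; proj₂; map₂)
  open import Data.Sum using (inj₁; inj₂; [_,_])
  open import Relation.Binary.PropositionalEquality
    using (refl; sym; trans; cong; cong₂; subst; subst₂; module ≡-Reasoning)
  open ≡-Reasoning

  at : ∀ {n} → Vec ℕ n → ℕ → ℕ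
  at w zero = 0
  at [] (suc i) = 0
  at (x ∷ w) (suc zero) = x
  at (x ∷ w) (suc (suc i)) = at w (suc i)

  at-∷ʳ : ∀ {n} (w : Vec ℕ n) x i → i ≤ n → at (w ∷ʳ x) i ≡ at w i
  at-∷ʳ w x zero _ = refl
  at-∷ʳ (y ∷ w) x (suc zero) _ = refl
  at-∷ʳ (y ∷ w) x (suc (suc i)) (s≤s i<n) = at-∷ʳ w x (suc i) i<n

  at-∷ʳ-last : ∀ {n} (w : Vec ℕ n) x → at (w ∷ʳ x) (suc n) ≡ x
  at-∷ʳ-last [] x = refl
  at-∷ʳ-last (y ∷ w) x = at-∷ʳ-last w x

  InLℕ : (n : ℕ) → Vec ℕ n → Set
  InLℕ n w = ∀ i → 1 ≤ i → i < n → suc i * at w i ≤ i * at w (suc i)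

  InLℕ-∷ʳ⁻ : ∀ {n} (w : Vec ℕ n) x → InLℕ (suc n) (w ∷ʳ x) → InLℕ n w × (suc n * at w n ≤ n * x)
  InLℕ-∷ʳ⁻ {zero} w x _ = (λ _ _ ()) , z≤n
  InLℕ-∷ʳ⁻ {suc n} w x w∷ʳx∈L =
    (λ i 1≤i i<n → subst₂ (λ a b → suc i * a ≤ i * b) (at-∷ʳ w x i (ℕ.<⇒≤ i<n)) (at-∷ʳ w x (suc i) i<n)
                          (w∷ʳx∈L i 1≤i (ℕ.m≤n⇒m≤1+n i<n))) ,
    subst₂ (λ a b → suc (suc n) * a ≤ suc n * b) (at-∷ʳ w x (suc n) ℕ.≤-refl) (at-∷ʳ-last w x)
           (w∷ʳx∈L (suc n) (s≤s z≤n) ℕ.≤-refl)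

  InLℕ-∷ʳ⁺ : ∀ {n} (w : Vec ℕ n) x → InLℕ n w → suc n * at w n ≤ n * x → InLℕ (suc n) (w ∷ʳ x)
  InLℕ-∷ʳ⁺ w x w∈L last≤ i 1≤i i<1+n with ℕ.m<1+n⇒m<n∨m≡n i<1+n
  ... | inj₁ i<n = subst₂ (λ a b → suc i * a ≤ i * b) (sym (at-∷ʳ w x i (ℕ.<⇒≤ i<n)))
                          (sym (at-∷ʳ w x (suc i) i<n)) (w∈L i 1≤i i<n)
  ... | inj₂ refl = subst₂ (λ a b → suc i * a ≤ i * b) (sym (at-∷ʳ w x i ℕ.≤-refl)) (sym (at-∷ʳ-last w x)) last≤

  -- The largest λₙ allowed below λₙ₊₁ = j.
  bound : ℕ → ℕ → ℕ
  bound n j = n * j / suc n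

  ≤-bound⁺ : ∀ n j i → suc n * i ≤ n * j → i ≤ bound n j
  ≤-bound⁺ n j i le = subst (_≤ bound n j) (m*n/n≡m i (suc n)) (/-monoˡ-≤ (suc n) (subst (_≤ n * j) (ℕ.*-comm (suc n) i) le))

  ≤-bound⁻ : ∀ n j i → i ≤ bound n j → suc n * i ≤ n * j
  ≤-bound⁻ n j i le = ℕ.≤-trans (subst (_≤ bound n j * suc n) (ℕ.*-comm i (suc n)) (ℕ.*-monoˡ-≤ (suc n) le))
                                (m/n*n≤m (n * j) (suc n))

  bound-zero : ∀ n → bound n 0 ≡ 0
  bound-zero n = cong (_/ suc n) (ℕ.*-zeroʳ n)

  bound-suc-mul : ∀ n q r → r ≤ n → bound n (suc n * q + suc r) ≡ n * q + r
  bound-suc-mul n q r r≤n with ℕ.m≤n⇒∃[o]m+o≡n r≤n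
  ... | e , refl = begin
    (r + e) * (suc (r + e) * q + suc r) / suc (r + e)
      ≡⟨ cong (_/ suc (r + e)) (expand q r e) ⟩
    (A * suc (r + e) + e) / suc (r + e)
      ≡⟨ +-distrib-/-∣ˡ e (n∣m*n A) ⟩
    A * suc (r + e) / suc (r + e) + e / suc (r + e)
      ≡⟨ cong₂ _+_ (m*n/n≡m A (suc (r + e))) (m<n⇒m/n≡0 (s≤s (ℕ.m≤n+m e r))) ⟩
    A + 0
      ≡⟨ ℕ.+-identityʳ A ⟩
    A ∎
    where
    A = (r + e) * q + r
    expand : ∀ q r e → (r + e) * (suc (r + e) * q + suc r) ≡ ((r + e) * q + r) * suc (r + e) + e
    expand = solve-∀

  points≤ : (n x : ℕ) → List (Vec ℕ n)
  points≡ : (n j : ℕ) → List (Vec ℕ (suc n))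
  points≤ zero x = [] ∷ []
  points≤ (suc n) zero = points≡ n zero
  points≤ (suc n) (suc x) = points≤ (suc n) x ++ points≡ n (suc x)
  points≡ n j = map (_∷ʳ j) (points≤ n (bound n j))

  points≤-sound : ∀ n x {w} → w ∈ points≤ n x → InLℕ n w × (at w n ≤ x)
  points≡-sound : ∀ n j {u} → u ∈ points≡ n j → InLℕ (suc n) u × (at u (suc n) ≡ j)
  points≤-sound zero x (here refl) = (λ _ _ ()) , z≤n
  points≤-sound (suc n) zero w∈ = map₂ ℕ.≤-reflexive (points≡-sound n zero w∈)
  points≤-sound (suc n) (suc x) w∈ =
    [ (λ w∈≤x → map₂ ℕ.m≤n⇒m≤1+n (points≤-sound (suc n) x w∈≤x))
    , (λ w∈≡1+x → map₂ ℕ.≤-reflexive (points≡-sound n (suc x) w∈≡1+x))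
    ] (∈-++⁻ (points≤ (suc n) x) w∈)
  points≡-sound n j {u} u∈ =
    let w , w∈ , u≡w∷ʳj = ∈-map⁻ (_∷ʳ j) u∈
        w∈L , w≤ = points≤-sound n (bound n j) w∈
    in subst (λ v → InLℕ (suc n) v × (at v (suc n) ≡ j)) (sym u≡w∷ʳj)
         (InLℕ-∷ʳ⁺ w j w∈L (≤-bound⁻ n j (at w n) w≤) , at-∷ʳ-last w j)

  points≤-complete : ∀ n x {w} → InLℕ n w → at w n ≤ x → w ∈ points≤ n x
  points≡-complete : ∀ n {u} → InLℕ (suc n) u → u ∈ points≡ n (at u (suc n))
  points≤-complete zero x {[]} _ _ = here refl
  points≤-complete (suc n) zero {u} u∈L u≤0 =
    subst (λ j → u ∈ points≡ n j) (ℕ.n≤0⇒n≡0 u≤0) (points≡-complete n u∈L)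
  points≤-complete (suc n) (suc x) {u} u∈L u≤1+x =
    [ (λ u<1+x → ∈-++⁺ˡ (points≤-complete (suc n) x u∈L (s≤s⁻¹ u<1+x)))
    , (λ u≡1+x → ∈-++⁺ʳ (points≤ (suc n) x) (subst (λ j → u ∈ points≡ n j) u≡1+x (points≡-complete n u∈L)))
    ] (ℕ.m≤n⇒m<n∨m≡n u≤1+x)
  points≡-complete n {u} u∈L =
    let w , x , u≡w∷ʳx = initLast u
        w∈L , last≤ = InLℕ-∷ʳ⁻ w x (subst (InLℕ (suc n)) u≡w∷ʳx u∈L)
    in subst (λ v → v ∈ points≡ n (at v (suc n))) (sym u≡w∷ʳx)
         (subst (λ j → (w ∷ʳ x) ∈ points≡ n j) (sym (at-∷ʳ-last w x))
           (∈-map⁺ (_∷ʳ x) (points≤-complete n (bound n x) w∈L (≤-bound⁺ n x (at w n) last≤))))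

  points≤-unique : ∀ n x → Unique (points≤ n x)
  points≡-unique : ∀ n j → Unique (points≡ n j)
  points≤-unique zero x = [] ∷ []
  points≤-unique (suc n) zero = points≡-unique n zero
  points≤-unique (suc n) (suc x) =
    Unique.++⁺ (points≤-unique (suc n) x) (points≡-unique n (suc x)) disjoint
    where
    disjoint : ∀ {u} → ¬ (u ∈ points≤ (suc n) x × u ∈ points≡ n (suc x))
    disjoint (u∈≤x , u∈≡1+x) =
      ℕ.<-irrefl refl (subst (_≤ x) (proj₂ (points≡-sound n (suc x) u∈≡1+x)) (proj₂ (points≤-sound (suc n) x u∈≤x)))
  points≡-unique n j = Unique.map⁺ (Vec.∷ʳ-injectiveˡ _ _) (points≤-unique n (bound n j))

  #points≤ : ℕ → ℕ → ℕ
  #points≤ n x = length (points≤ n x)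

  #points≤-suc-zero : ∀ n → #points≤ (suc n) 0 ≡ #points≤ n 0
  #points≤-suc-zero n = trans (List.length-map (_∷ʳ 0) (points≤ n (bound n 0))) (cong (#points≤ n) (bound-zero n))

  #points≤-suc-suc : ∀ n x → #points≤ (suc n) (suc x) ≡ #points≤ (suc n) x + #points≤ n (bound n (suc x))
  #points≤-suc-suc n x = trans (List.length-++ (points≤ (suc n) x))
    (cong (#points≤ (suc n) x +_) (List.length-map (_∷ʳ suc x) (points≤ n (bound n (suc x)))))

  #points≤-zero : ∀ n → #points≤ n 0 ≡ 1
  #points≤-zero zero = refl
  #points≤-zero (suc n) = trans (#points≤-suc-zero n) (#points≤-zero n)

  #points≤-closedForm : ∀ n q r → r ≤ n → #points≤ n (n * q + r) ≡ suc q ^ (n ∸ r) * suc (suc q) ^ r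
  #points≤-closedForm zero q zero z≤n = refl
  #points≤-closedForm (suc n) = closedForm
    where
    closedForm : ∀ q r → r ≤ suc n → #points≤ (suc n) (suc n * q + r) ≡ suc q ^ (suc n ∸ r) * suc (suc q) ^ r
    closedForm zero zero _ = begin
      #points≤ (suc n) (suc n * 0 + 0) ≡⟨ cong (#points≤ (suc n)) (trans (ℕ.+-identityʳ _) (ℕ.*-zeroʳ n)) ⟩
      #points≤ (suc n) 0               ≡⟨ #points≤-zero (suc n) ⟩
      1                                ≡⟨ trans (ℕ.*-identityʳ _) (ℕ.^-zeroˡ (suc n)) ⟨
      1 ^ suc n * 1 ∎
    closedForm (suc q) zero _ = begin
      #points≤ (suc n) (suc n * suc q + 0)
        ≡⟨ cong (#points≤ (suc n)) (trans (ℕ.+-identityʳ _) (trans (ℕ.*-suc (suc n) q) (ℕ.+-comm (suc n) _))) ⟩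
      #points≤ (suc n) (suc n * q + suc n)
        ≡⟨ closedForm q (suc n) ℕ.≤-refl ⟩
      suc q ^ (n ∸ n) * suc (suc q) ^ suc n
        ≡⟨ cong (λ e → suc q ^ e * suc (suc q) ^ suc n) (ℕ.n∸n≡0 n) ⟩
      1 * suc (suc q) ^ suc n
        ≡⟨ trans (ℕ.*-identityˡ _) (sym (ℕ.*-identityʳ _)) ⟩
      suc (suc q) ^ suc n * 1 ∎
    closedForm q (suc r) (s≤s r≤n) = begin
      #points≤ (suc n) (suc n * q + suc r)
        ≡⟨ cong (#points≤ (suc n)) (ℕ.+-suc (suc n * q) r) ⟩
      #points≤ (suc n) (suc (suc n * q + r))
        ≡⟨ #points≤-suc-suc n _ ⟩
      #points≤ (suc n) (suc n * q + r) + #points≤ n (bound n (suc (suc n * q + r)))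
        ≡⟨ cong₂ _+_ (closedForm q r (ℕ.m≤n⇒m≤1+n r≤n))
                     (cong (#points≤ n) (trans (cong (bound n) (sym (ℕ.+-suc (suc n * q) r))) (bound-suc-mul n q r r≤n))) ⟩
      suc q ^ (suc n ∸ r) * suc (suc q) ^ r + #points≤ n (n * q + r)
        ≡⟨ cong₂ (λ e y → suc q ^ e * suc (suc q) ^ r + y) (ℕ.+-∸-assoc 1 r≤n) (#points≤-closedForm n q r r≤n) ⟩
      suc q * suc q ^ (n ∸ r) * suc (suc q) ^ r + suc q ^ (n ∸ r) * suc (suc q) ^ r
        ≡⟨ collect q (suc q ^ (n ∸ r)) (suc (suc q) ^ r) ⟩
      suc q ^ (n ∸ r) * suc (suc q) ^ suc r ∎
      where
      collect : ∀ q a b → suc q * a * b + a * b ≡ a * (suc (suc q) * b)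
      collect = solve-∀

  1+m*a≤m*[a+k]⇔a≤m*k : ∀ m a k → suc m * a ≤ m * (a + k) ⇔ a ≤ m * k
  1+m*a≤m*[a+k]⇔a≤m*k m a k = mk⇔
    (λ le → ℕ.+-cancelˡ-≤ (m * a) a (m * k) (subst₂ _≤_ (ℕ.+-comm a (m * a)) (ℕ.*-distribˡ-+ m a k) le))
    (λ le → subst₂ _≤_ (ℕ.+-comm (m * a) a) (sym (ℕ.*-distribˡ-+ m a k)) (ℕ.+-monoʳ-≤ (m * a) le))

  pointsWithGap : (m k : ℕ) → List (Vec ℕ (suc m))
  pointsWithGap m k = map (λ w → w ∷ʳ (at w m + k)) (points≤ m (m * k))

  pointsWithGap-sound : ∀ m k {u} → u ∈ pointsWithGap m k → InLℕ (suc m) u × (at u (suc m) ≡ at u m + k)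
  pointsWithGap-sound m k {u} u∈ =
    let w , w∈ , u≡ = ∈-map⁻ (λ w → w ∷ʳ (at w m + k)) u∈
        w∈L , w≤ = points≤-sound m (m * k) w∈
    in subst (λ v → InLℕ (suc m) v × (at v (suc m) ≡ at v m + k)) (sym u≡)
         ( InLℕ-∷ʳ⁺ w (at w m + k) w∈L (Equivalence.from (1+m*a≤m*[a+k]⇔a≤m*k m (at w m) k) w≤)
         , trans (at-∷ʳ-last w _) (cong (_+ k) (sym (at-∷ʳ w _ m ℕ.≤-refl))))

  pointsWithGap-complete : ∀ m k {u} → InLℕ (suc m) u → at u (suc m) ≡ at u m + k → u ∈ pointsWithGap m k
  pointsWithGap-complete m k {u} u∈L gap =
    let w , x , u≡w∷ʳx = initLast u
        w∈L , last≤ = InLℕ-∷ʳ⁻ w x (subst (InLℕ (suc m)) u≡w∷ʳx u∈L)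
        x≡ : x ≡ at w m + k
        x≡ = trans (sym (at-∷ʳ-last w x))
               (trans (subst (λ v → at v (suc m) ≡ at v m + k) u≡w∷ʳx gap) (cong (_+ k) (at-∷ʳ w x m ℕ.≤-refl)))
        w≤ = Equivalence.to (1+m*a≤m*[a+k]⇔a≤m*k m (at w m) k) (subst (λ y → suc m * at w m ≤ m * y) x≡ last≤)
    in subst (_∈ pointsWithGap m k) (trans (cong (w ∷ʳ_) (sym x≡)) (sym u≡w∷ʳx))
         (∈-map⁺ (λ w → w ∷ʳ (at w m + k)) (points≤-complete m (m * k) w∈L w≤))

  pointsWithGap-unique : ∀ m k → Unique (pointsWithGap m k)
  pointsWithGap-unique m k = Unique.map⁺ (Vec.∷ʳ-injectiveˡ _ _) (points≤-unique m (m * k))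

  #pointsWithGap : ∀ m k → length (pointsWithGap m k) ≡ suc k ^ m
  #pointsWithGap m k = begin
    length (pointsWithGap m k)  ≡⟨ List.length-map _ (points≤ m (m * k)) ⟩
    #points≤ m (m * k)          ≡⟨ cong (#points≤ m) (ℕ.+-identityʳ (m * k)) ⟨
    #points≤ m (m * k + 0)      ≡⟨ #points≤-closedForm m k 0 z≤n ⟩
    suc k ^ m * 1               ≡⟨ ℕ.*-identityʳ _ ⟩
    suc k ^ m ∎

  InLℕ-gap : ∀ m {u} → InLℕ (suc m) u → at u m ≤ at u (suc m)
  InLℕ-gap m {u} u∈L =
    let w , x , u≡w∷ʳx = initLast u
        _ , last≤ = InLℕ-∷ʳ⁻ w x (subst (InLℕ (suc m)) u≡w∷ʳx u∈L)
    in subst (λ v → at v m ≤ at v (suc m)) (sym u≡w∷ʳx)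
         (subst₂ _≤_ (sym (at-∷ʳ w x m ℕ.≤-refl)) (sym (at-∷ʳ-last w x)) (lastStep m last≤))
    where
    lastStep : ∀ m {a x} → suc m * a ≤ m * x → a ≤ x
    lastStep zero {a} le = ℕ.≤-trans (subst (_≤ 0) (ℕ.+-identityʳ a) le) z≤n
    lastStep (suc m) {a} le = ℕ.*-cancelˡ-≤ (suc m) (ℕ.≤-trans (ℕ.m≤n+m (suc m * a) a) le)

open import Data.Nat using (zero; _^_; z≤n; s≤s)
import Data.Nat as ℕ
import Data.Nat.Properties as ℕ
open import Data.Integer using (ℤ; +_; -[1+_]; _-_; _≤_; ∣_∣; +≤+)
import Data.Integer as ℤ
import Data.Integer.Properties as ℤ
open import Data.Integer.Tactic.RingSolver using (solve-∀)
open import Data.Vec using ([]; _∷_)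
import Data.Vec as Vec
import Data.Vec.Properties as Vec
import Data.List as List
import Data.List.Properties as List
open import Data.List.Membership.Propositional.Properties using (∈-map⁺; ∈-map⁻)
import Data.List.Relation.Unary.Unique.Propositional.Properties as Unique
open import Data.Product using (_,_)
open import Function.Bundles using (mk⇔; Equivalence)
open import Relation.Binary.PropositionalEquality
  using (refl; sym; trans; cong; cong₂; subst; subst₂; _≗_; module ≡-Reasoning)
open ≡-Reasoning
open PowerSeries using (Δ^; powers; eulerianStep; *ₛ-oneMinusZ^; Δ^-powers-suc; eulerianStep-cong)
open EulerianNumbers using (#des; #des≡length-filter; #des-perms-suc-zero; #des-perms-suc)
open LectureHallPoints

toℤ : ∀ {n} → Vec ℕ n → Vec ℤ n
toℤ = Vec.map +_

toℤ-injective : ∀ {n} {u w : Vec ℕ n} → toℤ u ≡ toℤ w → u ≡ w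
toℤ-injective {u = []} {[]} _ = refl
toℤ-injective {u = x ∷ u} {y ∷ w} eq =
  let x≡y , u≡w = Vec.∷-injective eq in cong₂ _∷_ (ℤ.+-injective x≡y) (toℤ-injective u≡w)

coord-toℤ : ∀ {n} (w : Vec ℕ n) i → coord (toℤ w) i ≡ + at w i
coord-toℤ w zero = refl
coord-toℤ [] (suc i) = refl
coord-toℤ (x ∷ w) (suc zero) = refl
coord-toℤ (x ∷ w) (suc (suc i)) = coord-toℤ w (suc i)

InL-toℤ : ∀ n w → InL n (toℤ w) ⇔ InLℕ n w
InL-toℤ n w = mk⇔
  (λ (_ , w∈L) i 1≤i i<n → ℤ.drop‿+≤+ (subst₂ _≤_ (scaled (suc i) i) (scaled i (suc i)) (w∈L i 1≤i i<n)))
  (λ w∈L → subst (+ 0 ≤_) (sym (coord-toℤ w 1)) (+≤+ z≤n) ,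
           λ i 1≤i i<n → subst₂ _≤_ (sym (scaled (suc i) i)) (sym (scaled i (suc i))) (+≤+ (w∈L i 1≤i i<n)))
  where
  scaled : ∀ c i → + c ℤ.* coord (toℤ w) i ≡ + (c ℕ.* at w i)
  scaled c i = trans (cong (+ c ℤ.*_) (coord-toℤ w i)) (sym (ℤ.pos-* c (at w i)))

coord-nonNeg-step : ∀ {x y} c b → + 0 ≤ x → + c ℤ.* x ≤ + suc b ℤ.* y → + 0 ≤ y
coord-nonNeg-step {+ _} {+ _} _ _ _ _ = +≤+ z≤n
coord-nonNeg-step {+ t} { -[1+ _ ]} c b _ le with ℤ.≤-trans (subst (+ 0 ≤_) (ℤ.pos-* c t) (+≤+ z≤n)) le
... | ()

coord-nonNeg : ∀ n v → InL n v → ∀ i → 1 ℕ.≤ i → i ℕ.≤ n → + 0 ≤ coord v i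
coord-nonNeg n v (λ₁≥0 , _) 1 _ _ = λ₁≥0
coord-nonNeg n v v∈L@(_ , monotone) (suc (suc i)) _ i+2≤n =
  coord-nonNeg-step (suc (suc i)) i (coord-nonNeg n v v∈L (suc i) (s≤s z≤n) (ℕ.<⇒≤ i+2≤n))
                    (monotone (suc i) (s≤s z≤n) i+2≤n)

toℤ-∣∣ : ∀ {n} (v : Vec ℤ n) → (∀ i → 1 ℕ.≤ i → i ℕ.≤ n → + 0 ≤ coord v i) → toℤ (Vec.map ∣_∣ v) ≡ v
toℤ-∣∣ [] _ = refl
toℤ-∣∣ (x ∷ v) nonNeg =
  cong₂ _∷_ (ℤ.0≤i⇒+∣i∣≡i (nonNeg 1 (s≤s z≤n) (s≤s z≤n)))
            (toℤ-∣∣ v λ { (suc i) _ i<n → nonNeg (suc (suc i)) (s≤s z≤n) (s≤s i<n) })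

InL⇒InLℕ : ∀ n v → InL n v → Σ (Vec ℕ n) λ u → toℤ u ≡ v × InLℕ n u
InL⇒InLℕ n v v∈L =
  let u≡v = toℤ-∣∣ v (coord-nonNeg n v v∈L)
  in Vec.map ∣_∣ v , u≡v , Equivalence.to (InL-toℤ n _) (subst (InL n) (sym u≡v) v∈L)

+m-+n≡+k⇔m≡n+k : ∀ m n k → (+ m - + n ≡ + k) ⇔ (m ≡ n ℕ.+ k)
+m-+n≡+k⇔m≡n+k m n k = mk⇔
  (λ m-n≡k → ℤ.+-injective (begin
    + m                 ≡⟨ split (+ m) (+ n) ⟩
    + n ℤ.+ (+ m - + n) ≡⟨ cong (ℤ._+_ (+ n)) m-n≡k ⟩
    + n ℤ.+ + k         ≡⟨ ℤ.pos-+ n k ⟨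
    + (n ℕ.+ k) ∎))
  (λ { refl → trans (cong (_- + n) (ℤ.pos-+ n k)) (cancel (+ n) (+ k)) })
  where
  split : ∀ m n → m ≡ n ℤ.+ (m - n)
  split = solve-∀
  cancel : ∀ n k → (n ℤ.+ k) - n ≡ k
  cancel = solve-∀

gap-toℤ : ∀ m (u : Vec ℕ (suc m)) → coord (toℤ u) (suc m) - coord (toℤ u) m ≡ + at u (suc m) - + at u m
gap-toℤ m u = cong₂ _-_ (coord-toℤ u (suc m)) (coord-toℤ u m)

gap-nonNeg : ∀ m (v : Vec ℤ (suc m)) → InL (suc m) v → + 0 ≤ coord v (suc m) - coord v m
gap-nonNeg m v v∈L with InL⇒InLℕ (suc m) v v∈L
... | u , refl , u∈L = subst (+ 0 ≤_) (sym (gap-toℤ m u)) (ℤ.i≤j⇒0≤j-i (+≤+ (InLℕ-gap m u∈L)))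

gapPoints : (m k : ℕ) → List (Vec ℤ (suc m))
gapPoints m k = List.map toℤ (pointsWithGap m k)

gapPoints-sound : ∀ m k {v} → v ∈ gapPoints m k → InL (suc m) v × (coord v (suc m) - coord v m ≡ + k)
gapPoints-sound m k v∈ with ∈-map⁻ toℤ v∈
... | u , u∈ , refl =
  let u∈L , gap = pointsWithGap-sound m k u∈
  in Equivalence.from (InL-toℤ (suc m) u) u∈L ,
     trans (gap-toℤ m u) (Equivalence.from (+m-+n≡+k⇔m≡n+k (at u (suc m)) (at u m) k) gap)

gapPoints-complete : ∀ m k {v} → InL (suc m) v → coord v (suc m) - coord v m ≡ + k → v ∈ gapPoints m k
gapPoints-complete m k {v} v∈L gap with InL⇒InLℕ (suc m) v v∈L
... | u , refl , u∈L = ∈-map⁺ toℤ (pointsWithGap-complete m k u∈L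
  (Equivalence.to (+m-+n≡+k⇔m≡n+k (at u (suc m)) (at u m) k) (trans (sym (gap-toℤ m u)) gap)))

gapPoints-unique : ∀ m k → Unique (gapPoints m k)
gapPoints-unique m k = Unique.map⁺ toℤ-injective (pointsWithGap-unique m k)

#gapPoints : ∀ m k → length (gapPoints m k) ≡ suc k ^ m
#gapPoints m k = trans (List.length-map toℤ (pointsWithGap m k)) (#pointsWithGap m k)

eulerian≡#des : ∀ m d → eulerian m d ≡ + #des d (perms (List.upTo m))
eulerian≡#des m d = cong +_ (sym (#des≡length-filter d (perms (List.upTo m))))

recurrence-ℕ⇒ℤ : ∀ a b c k M → c ℕ.+ k ℕ.* b ≡ k ℕ.* a ℕ.+ M ℕ.* b → + c ≡ + k ℤ.* (+ a - + b) ℤ.+ + M ℤ.* + b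
recurrence-ℕ⇒ℤ a b c k M eq = begin
  + c                                        ≡⟨ split (+ c) (+ k ℤ.* + b) ⟩
  (+ c ℤ.+ + k ℤ.* + b) - + k ℤ.* + b        ≡⟨ cong (_- + k ℤ.* + b) eqℤ ⟩
  (+ k ℤ.* + a ℤ.+ + M ℤ.* + b) - + k ℤ.* + b ≡⟨ regroup (+ k) (+ a) (+ b) (+ M) ⟩
  + k ℤ.* (+ a - + b) ℤ.+ + M ℤ.* + b ∎
  where
  embed : ∀ x y z → + (x ℕ.+ y ℕ.* z) ≡ + x ℤ.+ + y ℤ.* + z
  embed x y z = trans (ℤ.pos-+ x (y ℕ.* z)) (cong (ℤ._+_ (+ x)) (ℤ.pos-* y z))
  eqℤ : + c ℤ.+ + k ℤ.* + b ≡ + k ℤ.* + a ℤ.+ + M ℤ.* + b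
  eqℤ = trans (sym (embed c k b))
          (trans (cong +_ eq) (trans (ℤ.pos-+ (k ℕ.* a) (M ℕ.* b)) (cong₂ ℤ._+_ (ℤ.pos-* k a) (ℤ.pos-* M b))))
  split : ∀ c x → c ≡ (c ℤ.+ x) - x
  split = solve-∀
  regroup : ∀ k a b M → (k ℤ.* a ℤ.+ M ℤ.* b) - k ℤ.* b ≡ k ℤ.* (a - b) ℤ.+ M ℤ.* b
  regroup = solve-∀

eulerian-suc : ∀ m → eulerian (suc m) ≗ eulerianStep m (eulerian m)
eulerian-suc m zero = begin
  eulerian (suc m) 0                         ≡⟨ eulerian≡#des (suc m) 0 ⟩
  + #des 0 (perms (List.upTo (suc m)))       ≡⟨ cong +_ (#des-perms-suc-zero m) ⟩
  + #des 0 (perms (List.upTo m))             ≡⟨ eulerian≡#des m 0 ⟨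
  eulerian m 0                               ≡⟨ padding (eulerian m 0) (+ suc (suc m)) ⟩
  eulerianStep m (eulerian m) 0 ∎
  where
  padding : ∀ e c → e ≡ + 1 ℤ.* e ℤ.+ c ℤ.* + 0
  padding = solve-∀
eulerian-suc m (suc d) = begin
  eulerian (suc m) (suc d)
    ≡⟨ eulerian≡#des (suc m) (suc d) ⟩
  + #des (suc d) (perms (List.upTo (suc m)))
    ≡⟨ recurrence-ℕ⇒ℤ (#des (suc d) Π) (#des d Π) _ (suc (suc d)) (suc (suc m)) (#des-perms-suc m d) ⟩
  + suc (suc d) ℤ.* (+ #des (suc d) Π - + #des d Π) ℤ.+ + suc (suc m) ℤ.* + #des d Π
    ≡⟨ cong₂ (λ a b → + suc (suc d) ℤ.* (a - b) ℤ.+ + suc (suc m) ℤ.* b)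
             (eulerian≡#des m (suc d)) (eulerian≡#des m d) ⟨
  eulerianStep m (eulerian m) (suc d) ∎
  where
  Π = perms (List.upTo m)

-- Worpitzky's identity (t + 1)ᵐ = Σ_d A(m, d) (t + m - d choose m), in difference form.
Δ^-powers≡eulerian : ∀ m → Δ^ (suc m) (powers m) ≗ eulerian m
Δ^-powers≡eulerian zero zero = refl
Δ^-powers≡eulerian zero (suc t) = refl
Δ^-powers≡eulerian (suc m) t = begin
  Δ^ (suc (suc m)) (powers (suc m)) t       ≡⟨ Δ^-powers-suc m t ⟩
  eulerianStep m (Δ^ (suc m) (powers m)) t  ≡⟨ eulerianStep-cong m (Δ^-powers≡eulerian m) t ⟩
  eulerianStep m (eulerian m) t             ≡⟨ eulerian-suc m t ⟨
  eulerian (suc m) t ∎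

theorem2 : (m : ℕ) →
    ((v : Vec ℤ (suc m)) → InL (suc m) v → + 0 ≤ coord v (suc m) - coord v m) ×
    Σ (ℕ → ℕ) (λ c →
      ((k : ℕ) → Σ (List (Vec ℤ (suc m))) (λ xs →
          Unique xs ×
          ((v : Vec ℤ (suc m)) → (v ∈ xs) ⇔ (InL (suc m) v × (coord v (suc m) - coord v m ≡ + k))) ×
          (length xs ≡ c k))) ×
      ((k : ℕ) → ((λ i → + c i) *ₛ (oneMinusZ ^ₛ suc m)) k ≡ eulerian m k))
theorem2 m =
  gap-nonNeg m ,
  (λ k → suc k ^ m) ,
  (λ k → gapPoints m k , gapPoints-unique m k ,
         (λ v → mk⇔ (gapPoints-sound m k) λ (v∈L , gap) → gapPoints-complete m k v∈L gap) ,
         #gapPoints m k) ,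
  (λ k → trans (*ₛ-oneMinusZ^ (suc m) (powers m) k) (Δ^-powers≡eulerian m k))
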